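{- Let $p$ be a prime and $k\ge 1$ an integer. Let $\psi(p^k)$ be the number of triples $(a,b,c)$ of integers with $1\le a,b,c\le p^k$, $\gcd(abc,p^k)=1$, $a+b+c\equiv 0\pmod p$ and $ab+bc+ca\equiv 0\pmod p$. Then \[ \psi(p^k)=\begin{cases} p^{3(k-1)}(p-1), &\text{if }p=3,\\ 2p^{3(k-1)}(p-1), &\text{if }p\equiv 1\pmod 3,\\ 0, &\text{if }p\equiv 2\pmod 3. \end{cases} \] -}

module Defs where

open import Data.Nat using (ℕ; zero; suc; _+_; _*_; _^_; _≟_; NonZero)
open import Data.Nat.DivMod using (_%_)
open import Data.Nat.GCD using (gcd)
open import Data.Nat.Primality using (Prime)
open import Data.List using (List; []; _∷_; length; filter; map; concatMap)
open import Data.Product using (_×_; _,_)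
open import Relation.Nullary.Decidable using (Dec; _×-dec_)
open import Relation.Binary.PropositionalEquality using (_≡_)

range1 : ℕ → List ℕ
range1 zero = []
range1 (suc n) = suc n ∷ range1 n

triples : ℕ → List (ℕ × ℕ × ℕ)
triples n = concatMap (λ a → concatMap (λ b → map (λ c → a , b , c) (range1 n)) (range1 n)) (range1 n)

Good : (p k : ℕ) .{{_ : NonZero p}} → ℕ × ℕ × ℕ → Set
Good p k (a , b , c) =
  (gcd (a * b * c) (p ^ k) ≡ 1) × (((a + b + c) % p ≡ 0) × ((a * b + b * c + c * a) % p ≡ 0))

good? : (p k : ℕ) .{{_ : NonZero p}} → (t : ℕ × ℕ × ℕ) → Dec (Good p k t)
good? p k (a , b , c) =
  (gcd (a * b * c) (p ^ k) ≟ 1) ×-dec (((a + b + c) % p ≟ 0) ×-dec ((a * b + b * c + c * a) % p ≟ 0))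

ψ : (p k : ℕ) .{{_ : NonZero p}} → ℕ
ψ p k = length (filter (good? p k) (triples (p ^ k)))

{-# OPTIONS --safe #-}
-- Admissibility of (a, b, c) only depends on residues mod p, so ψ(p^(k+1)) = p^(3k) ψ(p).
-- For a, b prime to p, the identity ab + bc + ca + Q(a, b) = (a + b)(a + b + c), where
-- Q(a, b) = a² + ab + b², leaves exactly one admissible residue c when p ∣ Q(a, b) and none
-- otherwise; as Q(a, ab) = a² Q(1, b), this gives ψ(p) = (p − 1) r, with r the number of roots
-- of b² + b + 1 mod p (r = 1 for p = 3). For p ≠ 3 the roots form a pair {b, −1 − b} of distinct
-- residues, so r ∈ {0, 2}; and r ≡ p − 2 (mod 3), because the roots are the fixed points of the
-- order-3 map b ↦ −1/(b + 1) on the p − 2 residues other than 0 and −1.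
module Submission where

open import Defs
open import Data.List using (List; length; filter; map; concatMap; _++_)
open import Data.List.Properties using (length-++; filter-++)
open import Data.Nat using (ℕ; zero; suc; _+_; _*_; _^_; _∸_; _≤_; _<_; _≥_; z≤n; s≤s; _≟_; _<?_; NonZero; pred; nonTrivial⇒n>1; anyUpTo?)
open import Data.Nat.Coprimality using (Coprime; coprime-divisor; coprime-Bézout; coprime⇒gcd≡1; gcd≡1⇒coprime)
open import Data.Nat.DivMod using (_%_; %-distribˡ-+; %-distribˡ-*; m%n%n≡m%n; [m+n]%n≡m%n; [m+kn]%n≡m%n; %-remove-+ˡ; m<n⇒m%n≡m; m%n<n; m%n≤n)
open import Data.Nat.Divisibility
open import Data.Nat.GCD using (gcd; module Bézout)
open import Data.Nat.Primality using (Prime; euclidsLemma; prime⇒nonZero; prime⇒nonTrivial; prime⇒irreducible; ¬prime[0]; ¬prime[1])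
open import Data.Nat.Properties
open import Algebra.Properties.CommutativeSemigroup +-commutativeSemigroup using (interchange; x∙yz≈y∙xz)
open import Data.Nat.Tactic.RingSolver using (solve-∀)
open import Data.Product using (∃-syntax; _×_; _,_; proj₁; proj₂; uncurry)
open import Data.Product.Function.NonDependent.Propositional using (_×-⇔_)
open import Data.Sum using (_⊎_; inj₁; inj₂; [_,_]′)
open import Function using (_∘_; flip; id)
open import Function.Bundles using (_⇔_; mk⇔; Equivalence)
open import Relation.Binary using (Setoid; tri<; tri≈; tri>)
import Relation.Binary.Reasoning.Setoid as SetoidReasoning
open import Relation.Binary.PropositionalEquality
  using (_≡_; _≢_; refl; sym; trans; cong; cong₂; subst; module ≡-Reasoning)
open import Relation.Nullary using (¬_; Dec; yes; no; ¬?; contradiction)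
open import Relation.Nullary.Decidable using (_×-dec_; _⊎-dec_)
open import Relation.Unary using (Pred; Decidable)

∑ : ℕ → (ℕ → ℕ) → ℕ
∑ zero    f = 0
∑ (suc n) f = f (suc n) + ∑ n f

∑-cong : ∀ n {f g : ℕ → ℕ} → (∀ i → 1 ≤ i → i ≤ n → f i ≡ g i) → ∑ n f ≡ ∑ n g
∑-cong zero    f≡g = refl
∑-cong (suc n) f≡g =
  cong₂ _+_ (f≡g (suc n) (s≤s z≤n) ≤-refl) (∑-cong n λ i 1≤i i≤n → f≡g i 1≤i (m≤n⇒m≤1+n i≤n))

∑-distrib-+ : ∀ n (f g : ℕ → ℕ) → ∑ n (λ i → f i + g i) ≡ ∑ n f + ∑ n g
∑-distrib-+ zero    f g = refl
∑-distrib-+ (suc n) f g = trans (cong (f (suc n) + g (suc n) +_) (∑-distrib-+ n f g))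
                                (interchange (f (suc n)) (g (suc n)) (∑ n f) (∑ n g))

∑-distribˡ-* : ∀ n c (f : ℕ → ℕ) → ∑ n (λ i → c * f i) ≡ c * ∑ n f
∑-distribˡ-* zero    c f = sym (*-zeroʳ c)
∑-distribˡ-* (suc n) c f = trans (cong (c * f (suc n) +_) (∑-distribˡ-* n c f))
                                 (sym (*-distribˡ-+ c (f (suc n)) (∑ n f)))

∑-const : ∀ n c → ∑ n (λ _ → c) ≡ n * c
∑-const zero    c = refl
∑-const (suc n) c = cong (c +_) (∑-const n c)

∑-zero : ∀ n {f : ℕ → ℕ} → (∀ i → 1 ≤ i → i ≤ n → f i ≡ 0) → ∑ n f ≡ 0
∑-zero n f≡0 = trans (∑-cong n f≡0) (trans (∑-const n 0) (*-zeroʳ n))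

∑-dropLast : ∀ n (f : ℕ → ℕ) → f n ≡ 0 → ∑ n f ≡ ∑ (pred n) f
∑-dropLast zero    f _   = refl
∑-dropLast (suc n) f f≡0 = cong (_+ ∑ n f) f≡0

∑-swap : ∀ m n (f : ℕ → ℕ → ℕ) → ∑ m (λ i → ∑ n (f i)) ≡ ∑ n (λ j → ∑ m (λ i → f i j))
∑-swap zero    n f = sym (∑-zero n λ _ _ _ → refl)
∑-swap (suc m) n f = begin
  ∑ n (f (suc m)) + ∑ m (λ i → ∑ n (f i))          ≡⟨ cong (∑ n (f (suc m)) +_) (∑-swap m n f) ⟩
  ∑ n (f (suc m)) + ∑ n (λ j → ∑ m (λ i → f i j))  ≡⟨ ∑-distrib-+ n (f (suc m)) _ ⟨
  ∑ n (λ j → ∑ (suc m) (λ i → f i j))              ∎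
  where open ≡-Reasoning

∑-+ : ∀ m n (f : ℕ → ℕ) → ∑ (m + n) f ≡ ∑ n f + ∑ m (λ i → f (i + n))
∑-+ zero    n f = sym (+-identityʳ _)
∑-+ (suc m) n f = trans (cong (f (suc (m + n)) +_) (∑-+ m n f))
                        (x∙yz≈y∙xz (f (suc m + n)) (∑ n f) (∑ m (λ i → f (i + n))))

∑-periodic : ∀ n (f : ℕ → ℕ) → (∀ i → f (i + n) ≡ f i) → ∀ m → ∑ (m * n) f ≡ m * ∑ n f
∑-periodic n f period zero    = refl
∑-periodic n f period (suc m) = begin
  ∑ (n + m * n) f                        ≡⟨ ∑-+ n (m * n) f ⟩
  ∑ (m * n) f + ∑ n (λ i → f (i + m * n)) ≡⟨ cong₂ _+_ (∑-periodic n f period m) (∑-cong n λ i _ _ → shift m i) ⟩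
  m * ∑ n f + ∑ n f                      ≡⟨ +-comm (m * ∑ n f) _ ⟩
  suc m * ∑ n f                          ∎
  where
  open ≡-Reasoning
  shift : ∀ m i → f (i + m * n) ≡ f i
  shift zero    i = cong f (+-identityʳ i)
  shift (suc m) i = trans (cong f (sym (+-assoc i n (m * n)))) (trans (shift m (i + n)) (period i))

χ : ∀ {a} {A : Set a} → Dec A → ℕ
χ (yes _) = 1
χ (no _)  = 0

module _ {a} {A : Set a} where

  χ-yes : (a? : Dec A) → A → χ a? ≡ 1
  χ-yes (yes _) _ = refl
  χ-yes (no ¬a) a = contradiction a ¬a

  χ-no : (a? : Dec A) → ¬ A → χ a? ≡ 0
  χ-no (yes a) ¬a = contradiction a ¬a
  χ-no (no _)  _  = refl

  χ-+-χ-¬ : (a? : Dec A) → χ a? + χ (¬? a?) ≡ 1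
  χ-+-χ-¬ (yes _) = refl
  χ-+-χ-¬ (no _)  = refl

module _ {a b} {A : Set a} {B : Set b} where

  χ-cong : (a? : Dec A) (b? : Dec B) → A ⇔ B → χ a? ≡ χ b?
  χ-cong a? (yes b) A⇔B = χ-yes a? (Equivalence.from A⇔B b)
  χ-cong a? (no ¬b) A⇔B = χ-no a? (λ a → ¬b (Equivalence.to A⇔B a))

  χ-⊎ : (a? : Dec A) (b? : Dec B) → ¬ (A × B) → χ (a? ⊎-dec b?) ≡ χ a? + χ b?
  χ-⊎ (yes a) (yes b) ¬a×b = contradiction (a , b) ¬a×b
  χ-⊎ (yes _) (no _)  _    = refl
  χ-⊎ (no _)  (yes _) _    = refl
  χ-⊎ (no _)  (no _)  _    = refl

∑-point : ∀ n x (g : ℕ → ℕ) → 1 ≤ x → x ≤ n → ∑ n (λ i → χ (i ≟ x) * g i) ≡ g x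
∑-point zero    (suc x) g _ ()
∑-point (suc n) x g 1≤x x≤1+n with m≤n⇒m<n∨m≡n x≤1+n
... | inj₂ refl = begin
  χ (x ≟ x) * g x + ∑ n (λ i → χ (i ≟ x) * g i) ≡⟨ cong₂ _+_ (cong (_* g x) (χ-yes (x ≟ x) refl)) (∑-zero n λ i _ i≤n →
                                                       cong (_* g i) (χ-no (i ≟ x) λ i≡x → <-irrefl i≡x (s≤s i≤n))) ⟩
  1 * g x + 0                                     ≡⟨ trans (+-identityʳ _) (*-identityˡ _) ⟩
  g x                                             ∎
  where open ≡-Reasoning
... | inj₁ x<1+n = cong₂ _+_ (cong (_* g (suc n)) (χ-no (suc n ≟ x) λ 1+n≡x → <-irrefl (sym 1+n≡x) x<1+n))
                              (∑-point n x g 1≤x (≤-pred x<1+n))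

∑-indicator : ∀ n x → 1 ≤ x → x ≤ n → ∑ n (λ i → χ (i ≟ x)) ≡ 1
∑-indicator n x 1≤x x≤n =
  trans (∑-cong n λ i _ _ → sym (*-identityʳ (χ (i ≟ x)))) (∑-point n x (λ _ → 1) 1≤x x≤n)

∑-χ≡0⊎∃ : ∀ n {ℓ} {P : Pred ℕ ℓ} (P? : Decidable P) → ∑ n (λ i → χ (P? i)) ≡ 0 ⊎ ∃[ i ] 1 ≤ i × i ≤ n × P i
∑-χ≡0⊎∃ zero    P? = inj₁ refl
∑-χ≡0⊎∃ (suc n) P? with P? (suc n) | ∑-χ≡0⊎∃ n P?
... | yes Pn | _                           = inj₂ (suc n , s≤s z≤n , ≤-refl , Pn)
... | no _   | inj₁ ∑≡0                    = inj₁ ∑≡0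
... | no _   | inj₂ (i , 1≤i , i≤n , Pi)   = inj₂ (i , 1≤i , m≤n⇒m≤1+n i≤n , Pi)

record Permutes (n : ℕ) (σ σ⁻¹ : ℕ → ℕ) : Set where
  field
    σ-closed      : ∀ i → 1 ≤ i → i ≤ n → 1 ≤ σ i × σ i ≤ n
    σ⁻¹-closed    : ∀ i → 1 ≤ i → i ≤ n → 1 ≤ σ⁻¹ i × σ⁻¹ i ≤ n
    inverseˡ      : ∀ i → 1 ≤ i → i ≤ n → σ⁻¹ (σ i) ≡ i
    inverseʳ      : ∀ i → 1 ≤ i → i ≤ n → σ (σ⁻¹ i) ≡ i

∑-permute : ∀ n {σ σ⁻¹ : ℕ → ℕ} → Permutes n σ σ⁻¹ → ∀ (h : ℕ → ℕ) → ∑ n (λ i → h (σ i)) ≡ ∑ n h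
∑-permute n {σ} {σ⁻¹} perm h = begin
  ∑ n (λ i → h (σ i))                                ≡⟨ ∑-cong n (λ i 1≤i i≤n → sym (uncurry (∑-point n (σ i) h) (σ-closed i 1≤i i≤n))) ⟩
  ∑ n (λ i → ∑ n (λ j → χ (j ≟ σ i) * h j))         ≡⟨ ∑-swap n n _ ⟩
  ∑ n (λ j → ∑ n (λ i → χ (j ≟ σ i) * h j))         ≡⟨ ∑-cong n (λ j 1≤j j≤n → ∑-cong n λ i 1≤i i≤n →
                                                         cong (_* h j) (χ-cong (j ≟ σ i) (i ≟ σ⁻¹ j) (solve j i 1≤j j≤n 1≤i i≤n))) ⟩
  ∑ n (λ j → ∑ n (λ i → χ (i ≟ σ⁻¹ j) * h j))       ≡⟨ ∑-cong n (λ j 1≤j j≤n → uncurry (∑-point n (σ⁻¹ j) (λ _ → h j)) (σ⁻¹-closed j 1≤j j≤n)) ⟩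
  ∑ n h                                              ∎
  where
  open ≡-Reasoning
  open Permutes perm
  solve : ∀ j i → 1 ≤ j → j ≤ n → 1 ≤ i → i ≤ n → (j ≡ σ i) ⇔ (i ≡ σ⁻¹ j)
  solve j i 1≤j j≤n 1≤i i≤n = mk⇔ (λ { refl → sym (inverseˡ i 1≤i i≤n) }) (λ { refl → sym (inverseʳ j 1≤j j≤n) })

isLeast : ℕ → ℕ → ℕ → ℕ
isLeast x y z = χ (x <? y ×-dec x <? z)

module _ {x y z : ℕ} where

  isLeast-yes : x < y → x < z → isLeast x y z ≡ 1
  isLeast-yes x<y x<z = χ-yes (x <? y ×-dec x <? z) (x<y , x<z)

  isLeast-noˡ : y < x → isLeast x y z ≡ 0
  isLeast-noˡ y<x = χ-no (x <? y ×-dec x <? z) (λ (x<y , _) → <-asym x<y y<x)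

  isLeast-noʳ : z < x → isLeast x y z ≡ 0
  isLeast-noʳ z<x = χ-no (x <? y ×-dec x <? z) (λ (_ , x<z) → <-asym x<z z<x)

exactlyOneLeast : ∀ {a b c} → a ≢ b → b ≢ c → c ≢ a → isLeast a b c + isLeast b c a + isLeast c a b ≡ 1
exactlyOneLeast {a} {b} {c} a≢b b≢c c≢a with <-cmp a b | <-cmp b c | <-cmp c a
... | tri≈ _ a≡b _ | _            | _            = contradiction a≡b a≢b
... | _            | tri≈ _ b≡c _ | _            = contradiction b≡c b≢c
... | _            | _            | tri≈ _ c≡a _ = contradiction c≡a c≢a
... | tri< a<b _ _ | tri< b<c _ _ | tri< c<a _ _ = contradiction (<-trans a<b (<-trans b<c c<a)) (<-irrefl refl)
... | tri> _ _ b<a | tri> _ _ c<b | tri> _ _ a<c = contradiction (<-trans a<c (<-trans c<b b<a)) (<-irrefl refl)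
... | tri< a<b _ _ | tri< b<c _ _ | tri> _ _ a<c = cong₂ _+_ (cong₂ _+_ (isLeast-yes a<b a<c) (isLeast-noʳ a<b)) (isLeast-noˡ a<c)
... | tri< a<b _ _ | tri> _ _ c<b | tri< c<a _ _ = cong₂ _+_ (cong₂ _+_ (isLeast-noʳ c<a) (isLeast-noˡ c<b)) (isLeast-yes c<a c<b)
... | tri< a<b _ _ | tri> _ _ c<b | tri> _ _ a<c = cong₂ _+_ (cong₂ _+_ (isLeast-yes a<b a<c) (isLeast-noˡ c<b)) (isLeast-noˡ a<c)
... | tri> _ _ b<a | tri< b<c _ _ | tri< c<a _ _ = cong₂ _+_ (cong₂ _+_ (isLeast-noˡ b<a) (isLeast-yes b<c b<a)) (isLeast-noʳ b<c)
... | tri> _ _ b<a | tri< b<c _ _ | tri> _ _ a<c = cong₂ _+_ (cong₂ _+_ (isLeast-noˡ b<a) (isLeast-yes b<c b<a)) (isLeast-noʳ b<c)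
... | tri> _ _ b<a | tri> _ _ c<b | tri< c<a _ _ = cong₂ _+_ (cong₂ _+_ (isLeast-noˡ b<a) (isLeast-noˡ c<b)) (isLeast-yes c<a c<b)

-- The non-fixed points fall into 3-cycles {i, f i, f (f i)}, each with exactly one least element,
-- and since f permutes [1, n] summing "is least in its cycle" over i, f i and f (f i) counts each cycle thrice.
fixedPoints≡[mod3] : ∀ n (f : ℕ → ℕ) →
  (∀ i → 1 ≤ i → i ≤ n → 1 ≤ f i × f i ≤ n) → (∀ i → 1 ≤ i → i ≤ n → f (f (f i)) ≡ i) →
  ∃[ q ] n ≡ 3 * q + ∑ n (λ i → χ (f i ≟ i))
fixedPoints≡[mod3] n f f-closed f³≡id = ∑ n L , (begin
  n                                                      ≡⟨ trans (∑-const n 1) (*-identityʳ n) ⟨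
  ∑ n (λ _ → 1)                                          ≡⟨ ∑-cong n (λ i _ _ → χ-+-χ-¬ (f i ≟ i)) ⟨
  ∑ n (λ i → χ (f i ≟ i) + χ (¬? (f i ≟ i)))              ≡⟨ ∑-distrib-+ n _ _ ⟩
  ∑ n (λ i → χ (f i ≟ i)) + ∑ n (λ i → χ (¬? (f i ≟ i)))  ≡⟨ +-comm (∑ n (λ i → χ (f i ≟ i))) _ ⟩
  ∑ n (λ i → χ (¬? (f i ≟ i))) + ∑ n (λ i → χ (f i ≟ i))  ≡⟨ cong (_+ ∑ n (λ i → χ (f i ≟ i))) nonFixed≡3∑L ⟩
  3 * ∑ n L + ∑ n (λ i → χ (f i ≟ i))                     ∎)
  where
  open ≡-Reasoning

  L : ℕ → ℕ
  L j = isLeast j (f j) (f (f j))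

  f∘f-closed : ∀ i → 1 ≤ i → i ≤ n → 1 ≤ f (f i) × f (f i) ≤ n
  f∘f-closed i 1≤i i≤n = let (1≤fi , fi≤n) = f-closed i 1≤i i≤n in f-closed (f i) 1≤fi fi≤n

  f-permutes : Permutes n f (λ i → f (f i))
  f-permutes = record { σ-closed = f-closed ; σ⁻¹-closed = f∘f-closed ; inverseˡ = f³≡id ; inverseʳ = f³≡id }

  f∘f-permutes : Permutes n (λ i → f (f i)) f
  f∘f-permutes = record { σ-closed = f∘f-closed ; σ⁻¹-closed = f-closed ; inverseˡ = f³≡id ; inverseʳ = f³≡id }

  L-fixed : ∀ {j} → f j ≡ j → L j ≡ 0
  L-fixed {j} fj≡j = χ-no (j <? f j ×-dec j <? f (f j)) (λ (j<fj , _) → <-irrefl (sym fj≡j) j<fj)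

  orbitSum : ∀ i → 1 ≤ i → i ≤ n → χ (¬? (f i ≟ i)) ≡ L i + L (f i) + L (f (f i))
  orbitSum i 1≤i i≤n with f i ≟ i
  ... | yes fi≡i = sym (cong₂ _+_ (cong₂ _+_ (L-fixed fi≡i) (L-fixed (cong f fi≡i))) (L-fixed (cong f (cong f fi≡i))))
  ... | no fi≢i  = sym (begin
    L i + L (f i) + L (f (f i))
      ≡⟨ cong (λ k → L i + isLeast (f i) (f (f i)) k + isLeast (f (f i)) k (f k)) (f³≡id i 1≤i i≤n) ⟩
    isLeast i (f i) (f (f i)) + isLeast (f i) (f (f i)) i + isLeast (f (f i)) i (f i)
      ≡⟨ exactlyOneLeast (fi≢i ∘ sym) fi≢ffi ffi≢i ⟩
    1 ∎)
    where
    fi≢ffi : f i ≢ f (f i)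
    fi≢ffi eq = fi≢i (sym (trans (sym (f³≡id i 1≤i i≤n)) (trans (cong (λ k → f (f k)) eq)
                  (uncurry (f³≡id (f i)) (f-closed i 1≤i i≤n)))))
    ffi≢i : f (f i) ≢ i
    ffi≢i eq = fi≢i (trans (sym (cong f eq)) (f³≡id i 1≤i i≤n))

  nonFixed≡3∑L : ∑ n (λ i → χ (¬? (f i ≟ i))) ≡ 3 * ∑ n L
  nonFixed≡3∑L = begin
    ∑ n (λ i → χ (¬? (f i ≟ i)))              ≡⟨ ∑-cong n orbitSum ⟩
    ∑ n (λ i → L i + L (f i) + L (f (f i)))   ≡⟨ ∑-distrib-+ n _ _ ⟩
    ∑ n (λ i → L i + L (f i)) + ∑ n (λ i → L (f (f i)))
                                              ≡⟨ cong₂ _+_ (∑-distrib-+ n _ _) (∑-permute n f∘f-permutes L) ⟩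
    ∑ n L + ∑ n (λ i → L (f i)) + ∑ n L       ≡⟨ cong (λ s → ∑ n L + s + ∑ n L) (∑-permute n f-permutes L) ⟩
    ∑ n L + ∑ n L + ∑ n L                     ≡⟨ thrice (∑ n L) ⟩
    3 * ∑ n L                                 ∎
    where
    thrice : ∀ q → q + q + q ≡ 3 * q
    thrice q = trans (+-assoc q q q) (cong (q +_) (cong (q +_) (sym (+-identityʳ q))))

module _ {A : Set} {ℓ} {P : Pred A ℓ} (P? : Decidable P) where

  length-filter-map : ∀ (h : ℕ → A) n → length (filter P? (map h (range1 n))) ≡ ∑ n (λ i → χ (P? (h i)))
  length-filter-map h zero    = refl
  length-filter-map h (suc n) with P? (h (suc n))
  ... | yes _ = cong suc (length-filter-map h n)
  ... | no _  = length-filter-map h n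

  length-filter-concatMap : ∀ (g : ℕ → List A) n →
    length (filter P? (concatMap g (range1 n))) ≡ ∑ n (λ i → length (filter P? (g i)))
  length-filter-concatMap g zero    = refl
  length-filter-concatMap g (suc n) = begin
    length (filter P? (g (suc n) ++ concatMap g (range1 n)))
      ≡⟨ cong length (filter-++ P? (g (suc n)) _) ⟩
    length (filter P? (g (suc n)) ++ filter P? (concatMap g (range1 n)))
      ≡⟨ length-++ (filter P? (g (suc n))) ⟩
    length (filter P? (g (suc n))) + length (filter P? (concatMap g (range1 n)))
      ≡⟨ cong (length (filter P? (g (suc n))) +_) (length-filter-concatMap g n) ⟩
    ∑ (suc n) (λ i → length (filter P? (g i))) ∎
    where open ≡-Reasoning

∑³ : ℕ → (ℕ → ℕ → ℕ → ℕ) → ℕ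
∑³ n f = ∑ n λ a → ∑ n λ b → ∑ n λ c → f a b c

length-filter-triples : ∀ {ℓ} {P : Pred (ℕ × ℕ × ℕ) ℓ} (P? : Decidable P) n →
  length (filter P? (triples n)) ≡ ∑³ n (λ a b c → χ (P? (a , b , c)))
length-filter-triples P? n =
  trans (length-filter-concatMap P? _ n) (∑-cong n λ a _ _ →
  trans (length-filter-concatMap P? _ n) (∑-cong n λ b _ _ →
  length-filter-map P? _ n))

∑³-periodic : ∀ n (f : ℕ → ℕ → ℕ → ℕ) →
  (∀ a b c → f (a + n) b c ≡ f a b c) → (∀ a b c → f a (b + n) c ≡ f a b c) → (∀ a b c → f a b (c + n) ≡ f a b c) →
  ∀ m → ∑³ (m * n) f ≡ m ^ 3 * ∑³ n f
∑³-periodic n f periodᵃ periodᵇ periodᶜ m = begin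
  ∑³ (m * n) f
    ≡⟨ ∑-periodic n _ (λ a → ∑-cong (m * n) λ b _ _ → ∑-cong (m * n) λ c _ _ → periodᵃ a b c) m ⟩
  m * ∑ n (λ a → ∑ (m * n) λ b → ∑ (m * n) λ c → f a b c)
    ≡⟨ cong (m *_) (∑-cong n λ a _ _ → ∑-periodic n _ (λ b → ∑-cong (m * n) λ c _ _ → periodᵇ a b c) m) ⟩
  m * ∑ n (λ a → m * ∑ n λ b → ∑ (m * n) λ c → f a b c)
    ≡⟨ cong (m *_) (∑-cong n λ a _ _ → cong (m *_) (∑-cong n λ b _ _ → ∑-periodic n (f a b) (periodᶜ a b) m)) ⟩
  m * ∑ n (λ a → m * ∑ n λ b → m * ∑ n λ c → f a b c)
    ≡⟨ cong (m *_) (∑-cong n λ a _ _ → cong (m *_) (∑-distribˡ-* n m _)) ⟩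
  m * ∑ n (λ a → m * (m * ∑ n λ b → ∑ n λ c → f a b c))
    ≡⟨ cong (m *_) (trans (∑-distribˡ-* n m _) (cong (m *_) (∑-distribˡ-* n m _))) ⟩
  m * (m * (m * ∑³ n f))
    ≡⟨ cube m (∑³ n f) ⟩
  m ^ 3 * ∑³ n f ∎
  where
  open ≡-Reasoning
  cube : ∀ m x → m * (m * (m * x)) ≡ m ^ 3 * x
  cube m x = sym (trans (cong (λ t → m * (m * t) * x) (*-identityʳ m))
                        (trans (*-assoc m (m * m) x) (cong (m *_) (*-assoc m m x))))

∑³-dropLast : ∀ n (f : ℕ → ℕ → ℕ → ℕ) →
  (∀ b c → f n b c ≡ 0) → (∀ a c → f a n c ≡ 0) → (∀ a b → f a b n ≡ 0) → ∑³ n f ≡ ∑³ (pred n) f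
∑³-dropLast n f f[n,-,-]≡0 f[-,n,-]≡0 f[-,-,n]≡0 = begin
  ∑ n (λ a → ∑ n λ b → ∑ n λ c → f a b c)
    ≡⟨ ∑-cong n (λ a _ _ → ∑-cong n λ b _ _ → ∑-dropLast n (f a b) (f[-,-,n]≡0 a b)) ⟩
  ∑ n (λ a → ∑ n λ b → ∑ (pred n) λ c → f a b c)
    ≡⟨ ∑-cong n (λ a _ _ → ∑-dropLast n _ (∑-zero (pred n) λ c _ _ → f[-,n,-]≡0 a c)) ⟩
  ∑ n (λ a → ∑ (pred n) λ b → ∑ (pred n) λ c → f a b c)
    ≡⟨ ∑-dropLast n _ (∑-zero (pred n) λ b _ _ → ∑-zero (pred n) λ c _ _ → f[n,-,-]≡0 b c) ⟩
  ∑³ (pred n) f ∎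
  where open ≡-Reasoning

∣m+n∣n⇒∣m : ∀ {d m n} → d ∣ m + n → d ∣ n → d ∣ m
∣m+n∣n⇒∣m {d} {m} {n} d∣m+n d∣n = ∣m+n∣m⇒∣n (subst (d ∣_) (+-comm m n) d∣m+n) d∣n

module Residues (p : ℕ) .{{_ : NonZero p}} where

  infix 4 _≈_
  record _≈_ (x y : ℕ) : Set where
    constructor mk≈
    field %-≡ : x % p ≡ y % p

  ≈-reflexive : ∀ {x y} → x ≡ y → x ≈ y
  ≈-reflexive x≡y = mk≈ (cong (_% p) x≡y)

  ≈-refl : ∀ {x} → x ≈ x
  ≈-refl = ≈-reflexive refl

  ≈-sym : ∀ {x y} → x ≈ y → y ≈ x
  ≈-sym (mk≈ eq) = mk≈ (sym eq)

  ≈-trans : ∀ {x y z} → x ≈ y → y ≈ z → x ≈ z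
  ≈-trans (mk≈ eq) (mk≈ eq′) = mk≈ (trans eq eq′)

  ≈-setoid : Setoid _ _
  ≈-setoid = record
    { _≈_ = _≈_
    ; isEquivalence = record { refl = ≈-refl ; sym = ≈-sym ; trans = ≈-trans }
    }

  module ≈-Reasoning = SetoidReasoning ≈-setoid

  +-cong : ∀ {a a′ b b′} → a ≈ a′ → b ≈ b′ → a + b ≈ a′ + b′
  +-cong {a} {a′} {b} {b′} (mk≈ eq) (mk≈ eq′) = mk≈ (begin
    (a + b) % p             ≡⟨ %-distribˡ-+ a b p ⟩
    (a % p + b % p) % p     ≡⟨ cong₂ (λ u v → (u + v) % p) eq eq′ ⟩
    (a′ % p + b′ % p) % p   ≡⟨ %-distribˡ-+ a′ b′ p ⟨
    (a′ + b′) % p           ∎)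
    where open ≡-Reasoning

  *-cong : ∀ {a a′ b b′} → a ≈ a′ → b ≈ b′ → a * b ≈ a′ * b′
  *-cong {a} {a′} {b} {b′} (mk≈ eq) (mk≈ eq′) = mk≈ (begin
    (a * b) % p             ≡⟨ %-distribˡ-* a b p ⟩
    (a % p * (b % p)) % p   ≡⟨ cong₂ (λ u v → (u * v) % p) eq eq′ ⟩
    (a′ % p * (b′ % p)) % p ≡⟨ %-distribˡ-* a′ b′ p ⟨
    (a′ * b′) % p           ∎)
    where open ≡-Reasoning

  %-≈ : ∀ x → x % p ≈ x
  %-≈ x = mk≈ (m%n%n≡m%n x p)

  +p-≈ : ∀ x → x + p ≈ x
  +p-≈ x = mk≈ ([m+n]%n≡m%n x p)

  ∣-resp-≈ : ∀ {x y} → x ≈ y → p ∣ x → p ∣ y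
  ∣-resp-≈ {x} {y} (mk≈ eq) p∣x = m%n≡0⇒n∣m y p (trans (sym eq) (n∣m⇒m%n≡0 x p p∣x))

  ∣∧∣⇒≈ : ∀ {x y} → p ∣ x → p ∣ y → x ≈ y
  ∣∧∣⇒≈ {x} {y} p∣x p∣y = mk≈ (trans (n∣m⇒m%n≡0 x p p∣x) (sym (n∣m⇒m%n≡0 y p p∣y)))

  ∣⇒+-≈ : ∀ {d} x → p ∣ d → d + x ≈ x
  ∣⇒+-≈ x p∣d = mk≈ (%-remove-+ˡ x p∣d)

  ≈⇒≡ : ∀ {x y} → x ≈ y → x < p → y < p → x ≡ y
  ≈⇒≡ (mk≈ eq) x<p y<p = trans (sym (m<n⇒m%n≡m x<p)) (trans eq (m<n⇒m%n≡m y<p))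

  ∤-residue : ∀ {a} → 1 ≤ a → a < p → ¬ p ∣ a
  ∤-residue {suc _} _ a<p = >⇒∤ a<p

  -- Minus x modulo p, taken in [1, p]: neg x ≡ p, not 0, when p ∣ x.
  neg : ℕ → ℕ
  neg x = p ∸ x % p

  ∣+neg : ∀ x → p ∣ x + neg x
  ∣+neg x = ∣-resp-≈ (+-cong (%-≈ x) ≈-refl) (subst (p ∣_) (sym (m+[n∸m]≡n (m%n≤n x p))) ∣-refl)

  +-cancelˡ-≈ : ∀ x {y z} → x + y ≈ x + z → y ≈ z
  +-cancelˡ-≈ x {y} {z} x+y≈x+z = begin
    y                   ≈⟨ ∣⇒+-≈ y p∣neg+x ⟨
    neg x + x + y       ≡⟨ +-assoc (neg x) x y ⟩
    neg x + (x + y)     ≈⟨ +-cong (≈-refl {neg x}) x+y≈x+z ⟩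
    neg x + (x + z)     ≡⟨ +-assoc (neg x) x z ⟨
    neg x + x + z       ≈⟨ ∣⇒+-≈ z p∣neg+x ⟩
    z                   ∎
    where
    open ≈-Reasoning
    p∣neg+x = subst (p ∣_) (+-comm x (neg x)) (∣+neg x)

  +-cancelʳ-≈ : ∀ x {y z} → y + x ≈ z + x → y ≈ z
  +-cancelʳ-≈ x {y} {z} y+x≈z+x =
    +-cancelˡ-≈ x (≈-trans (≈-reflexive (+-comm x y)) (≈-trans y+x≈z+x (≈-reflexive (+-comm z x))))

  ∣+-unique : ∀ {x y z} → p ∣ x + y → p ∣ x + z → y < p → z < p → y ≡ z
  ∣+-unique {x} p∣x+y p∣x+z = ≈⇒≡ (+-cancelˡ-≈ x (∣∧∣⇒≈ p∣x+y p∣x+z))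


module PrimeResidues {p : ℕ} (p-prime : Prime p) where

  instance
    p-nonZero : NonZero p
    p-nonZero = prime⇒nonZero p-prime

  open Residues p public

  1<p : 1 < p
  1<p = nonTrivial⇒n>1 p {{prime⇒nonTrivial p-prime}}

  p∤1 : ¬ p ∣ 1
  p∤1 p∣1 = ¬prime[1] (subst Prime (∣1⇒≡1 p∣1) p-prime)

  ∤-* : ∀ {a b} → ¬ p ∣ a → ¬ p ∣ b → ¬ p ∣ a * b
  ∤-* {a} {b} p∤a p∤b p∣ab = [ p∤a , p∤b ]′ (euclidsLemma a b p-prime p∣ab)

  ∣*⇔∣ : ∀ {c x} → ¬ p ∣ c → p ∣ c * x ⇔ p ∣ x
  ∣*⇔∣ {c} {x} p∤c = mk⇔ (λ p∣cx → [ flip contradiction p∤c , id ]′ (euclidsLemma c x p-prime p∣cx)) (∣n⇒∣m*n c)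

  ∤⇒1≤% : ∀ {x} → ¬ p ∣ x → 1 ≤ x % p
  ∤⇒1≤% {x} p∤x = n≢0⇒n>0 λ x%p≡0 → p∤x (m%n≡0⇒n∣m x p x%p≡0)

  neg-residue : ∀ {x} → ¬ p ∣ x → 1 ≤ neg x × neg x < p
  neg-residue {x} p∤x = m<n⇒0<n∸m (m%n<n x p) , ∸-monoʳ-< (∤⇒1≤% p∤x) (m%n≤n x p)

  ∤⇒coprime : ∀ {x} → ¬ p ∣ x → Coprime x p
  ∤⇒coprime p∤x (d∣x , d∣p) with prime⇒irreducible p-prime d∣p
  ... | inj₁ d≡1 = d≡1
  ... | inj₂ refl = contradiction d∣x p∤x

  ∤⇒coprime-^ : ∀ {x} → ¬ p ∣ x → ∀ k → Coprime x (p ^ k)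
  ∤⇒coprime-^ p∤x zero    (_ , d∣1)      = ∣1⇒≡1 d∣1
  ∤⇒coprime-^ p∤x (suc k) (d∣x , d∣p^1+k) =
    ∤⇒coprime-^ p∤x k (d∣x , coprime-divisor (λ (e∣d , e∣p) → ∤⇒coprime p∤x (∣-trans e∣d d∣x , e∣p)) d∣p^1+k)

  gcd[-,p^1+k]≡1⇔∤ : ∀ k x → gcd x (p ^ suc k) ≡ 1 ⇔ (¬ p ∣ x)
  gcd[-,p^1+k]≡1⇔∤ k x = mk⇔
    (λ gcd≡1 p∣x → ¬prime[1] (subst Prime (gcd≡1⇒coprime gcd≡1 (p∣x , m∣m*n (p ^ k))) p-prime))
    (λ p∤x → coprime⇒gcd≡1 (∤⇒coprime-^ p∤x (suc k)))

  ∃-inverse : ∀ {x} → ¬ p ∣ x → ∃[ u ] u * x ≈ 1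
  ∃-inverse {x} p∤x with coprime-Bézout (∤⇒coprime p∤x)
  ... | Bézout.+- u v 1+vp≡ux = u , ≈-trans (≈-reflexive (sym 1+vp≡ux)) (mk≈ ([m+kn]%n≡m%n 1 v p))
  ... | Bézout.-+ u v 1+ux≡vp = pred p * u , (begin
    pred p * u * x     ≡⟨ *-assoc (pred p) u x ⟩
    pred p * (u * x)   ≈⟨ +-cancelˡ-≈ (pred p) (∣∧∣⇒≈ p∣p-1+[p-1]ux p∣p-1+1) ⟩
    1                  ∎)
    where
    open ≈-Reasoning
    p∣p-1+[p-1]ux : p ∣ pred p + pred p * (u * x)
    p∣p-1+[p-1]ux = subst (p ∣_) (trans (*-distribˡ-+ (pred p) 1 (u * x)) (cong (_+ pred p * (u * x)) (*-identityʳ (pred p))))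
                      (∣n⇒∣m*n (pred p) (subst (p ∣_) (sym 1+ux≡vp) (n∣m*n v)))
    p∣p-1+1 : p ∣ pred p + 1
    p∣p-1+1 = subst (p ∣_) (sym (trans (+-comm (pred p) 1) (suc-pred p))) ∣-refl

  ∃-negInverse : ∀ {x} → ¬ p ∣ x → ∃[ y ] y < p × p ∣ y * x + 1
  ∃-negInverse {x} p∤x with ∃-inverse p∤x
  ... | u , ux≈1 = y , m%n<n (pred p * u) p , ∣-resp-≈ (≈-sym y*x+1≈p) ∣-refl
    where
    open ≈-Reasoning
    y = (pred p * u) % p
    y*x+1≈p : y * x + 1 ≈ p
    y*x+1≈p = begin
      y * x + 1               ≈⟨ +-cong (*-cong (%-≈ (pred p * u)) (≈-refl {x})) (≈-refl {1}) ⟩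
      pred p * u * x + 1      ≡⟨ cong (_+ 1) (*-assoc (pred p) u x) ⟩
      pred p * (u * x) + 1    ≈⟨ +-cong (*-cong (≈-refl {pred p}) ux≈1) (≈-refl {1}) ⟩
      pred p * 1 + 1          ≡⟨ trans (cong (_+ 1) (*-identityʳ (pred p))) (trans (+-comm (pred p) 1) (suc-pred p)) ⟩
      p                       ∎

  *-cancelʳ-≈ : ∀ {a b c} → ¬ p ∣ c → a * c ≈ b * c → a ≈ b
  *-cancelʳ-≈ {a} {b} {c} p∤c ac≈bc with ∃-inverse p∤c
  ... | u , uc≈1 = begin
    a             ≡⟨ *-identityʳ a ⟨
    a * 1         ≈⟨ *-cong (≈-refl {a}) (≈-sym uc≈1) ⟩
    a * (u * c)   ≡⟨ regroup a ⟩
    a * c * u     ≈⟨ *-cong ac≈bc (≈-refl {u}) ⟩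
    b * c * u     ≡⟨ regroup b ⟨
    b * (u * c)   ≈⟨ *-cong (≈-refl {b}) uc≈1 ⟩
    b * 1         ≡⟨ *-identityʳ b ⟩
    b             ∎
    where
    open ≈-Reasoning
    regroup : ∀ y → y * (u * c) ≡ y * c * u
    regroup y = trans (cong (y *_) (*-comm u c)) (sym (*-assoc y c u))

  negInverse-unique : ∀ {x y y′} → ¬ p ∣ x → p ∣ y * x + 1 → p ∣ y′ * x + 1 → y < p → y′ < p → y ≡ y′
  negInverse-unique p∤x p∣yx+1 p∣y′x+1 = ≈⇒≡ (*-cancelʳ-≈ p∤x (+-cancelʳ-≈ 1 (∣∧∣⇒≈ p∣yx+1 p∣y′x+1)))

Q : ℕ → ℕ → ℕ
Q a b = a * a + a * b + b * b

e₂+Q≡[a+b]*[a+b+c] : ∀ a b c → (a * b + b * c + c * a) + (a * a + a * b + b * b) ≡ (a + b) * (a + b + c)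
e₂+Q≡[a+b]*[a+b+c] = solve-∀

Q≡a²+b[a+b] : ∀ a b → a * a + a * b + b * b ≡ a * a + b * (a + b)
Q≡a²+b[a+b] = solve-∀

-- Q a c − Q a b = (c − b)(a + b + c), with both sides moved so that no subtraction occurs.
Q-difference : ∀ a b c → (a * a + a * c + c * c) + b * (a + b + c) ≡ (a * a + a * b + b * b) + c * (a + b + c)
Q-difference = solve-∀

4Q≡square+3a² : ∀ a b → 4 * (a * a + a * b + b * b) ≡ (a + b + b) * (a + b + b) + 3 * (a * a)
4Q≡square+3a² = solve-∀

Q-scale : ∀ a b → a * a + a * (a * b) + a * b * (a * b) ≡ (a * a) * (1 * 1 + 1 * b + b * b)
Q-scale = solve-∀

Admissible : ℕ → ℕ → ℕ → ℕ → Set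
Admissible p a b c = ¬ p ∣ a * b * c × p ∣ a + b + c × p ∣ a * b + b * c + c * a

admissible? : ∀ p a b c → Dec (Admissible p a b c)
admissible? p a b c = ¬? (p ∣? a * b * c) ×-dec p ∣? a + b + c ×-dec p ∣? a * b + b * c + c * a

module Counting {p : ℕ} (p-prime : Prime p) where

  open PrimeResidues p-prime

  Good⇔Admissible : ∀ k a b c → Good p (suc k) (a , b , c) ⇔ Admissible p a b c
  Good⇔Admissible k a b c =
    gcd[-,p^1+k]≡1⇔∤ k (a * b * c) ×-⇔ m%n≡0⇔n∣m (a + b + c) p ×-⇔ m%n≡0⇔n∣m (a * b + b * c + c * a) p

  Admissible-resp-≈ : ∀ {a a′ b b′ c c′} → a ≈ a′ → b ≈ b′ → c ≈ c′ → Admissible p a b c → Admissible p a′ b′ c′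
  Admissible-resp-≈ a≈ b≈ c≈ (p∤abc , p∣a+b+c , p∣e₂) =
    (λ p∣ → p∤abc (∣-resp-≈ (≈-sym (*-cong (*-cong a≈ b≈) c≈)) p∣)) ,
    ∣-resp-≈ (+-cong (+-cong a≈ b≈) c≈) p∣a+b+c ,
    ∣-resp-≈ (+-cong (+-cong (*-cong a≈ b≈) (*-cong b≈ c≈)) (*-cong c≈ a≈)) p∣e₂

  χ-admissible-cong : ∀ {a a′ b b′ c c′} → a ≈ a′ → b ≈ b′ → c ≈ c′ →
    χ (admissible? p a b c) ≡ χ (admissible? p a′ b′ c′)
  χ-admissible-cong {a} {a′} {b} {b′} {c} {c′} a≈ b≈ c≈ = χ-cong (admissible? p a b c) (admissible? p a′ b′ c′)
    (mk⇔ (Admissible-resp-≈ a≈ b≈ c≈) (Admissible-resp-≈ (≈-sym a≈) (≈-sym b≈) (≈-sym c≈)))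

  ψ≡p^3k*∑³ : ∀ k → ψ p (suc k) ≡ p ^ (3 * k) * ∑³ p (λ a b c → χ (admissible? p a b c))
  ψ≡p^3k*∑³ k = begin
    ψ p (suc k)
      ≡⟨ length-filter-triples (good? p (suc k)) (p * p ^ k) ⟩
    ∑³ (p * p ^ k) (λ a b c → χ (good? p (suc k) (a , b , c)))
      ≡⟨ ∑-cong (p * p ^ k) (λ a _ _ → ∑-cong (p * p ^ k) λ b _ _ → ∑-cong (p * p ^ k) λ c _ _ →
           χ-cong (good? p (suc k) (a , b , c)) (admissible? p a b c) (Good⇔Admissible k a b c)) ⟩
    ∑³ (p * p ^ k) (λ a b c → χ (admissible? p a b c))
      ≡⟨ cong (λ n → ∑³ n (λ a b c → χ (admissible? p a b c))) (*-comm p (p ^ k)) ⟩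
    ∑³ (p ^ k * p) (λ a b c → χ (admissible? p a b c))
      ≡⟨ ∑³-periodic p _ (λ a b c → χ-admissible-cong (+p-≈ a) (≈-refl {b}) (≈-refl {c}))
                         (λ a b c → χ-admissible-cong (≈-refl {a}) (+p-≈ b) (≈-refl {c}))
                         (λ a b c → χ-admissible-cong (≈-refl {a}) (≈-refl {b}) (+p-≈ c)) (p ^ k) ⟩
    (p ^ k) ^ 3 * ∑³ p (λ a b c → χ (admissible? p a b c))
      ≡⟨ cong (_* ∑³ p (λ a b c → χ (admissible? p a b c))) (trans (^-*-assoc p k 3) (cong (p ^_) (*-comm k 3))) ⟩
    p ^ (3 * k) * ∑³ p (λ a b c → χ (admissible? p a b c)) ∎
    where open ≡-Reasoning

  ∣e₂⇔∣Q : ∀ a b c → p ∣ a + b + c → p ∣ a * b + b * c + c * a ⇔ p ∣ Q a b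
  ∣e₂⇔∣Q a b c p∣a+b+c = mk⇔ (∣m+n∣m⇒∣n p∣e₂+Q) (∣m+n∣n⇒∣m p∣e₂+Q)
    where
    p∣e₂+Q : p ∣ (a * b + b * c + c * a) + Q a b
    p∣e₂+Q = subst (p ∣_) (sym (e₂+Q≡[a+b]*[a+b+c] a b c)) (∣n⇒∣m*n (a + b) p∣a+b+c)

  ∣Q⇒∤a+b : ∀ {a b} → ¬ p ∣ a → p ∣ Q a b → ¬ p ∣ a + b
  ∣Q⇒∤a+b {a} {b} p∤a p∣Q p∣a+b =
    ∤-* p∤a p∤a (∣m+n∣n⇒∣m (subst (p ∣_) (Q≡a²+b[a+b] a b) p∣Q) (∣n⇒∣m*n b p∣a+b))

  ∑-admissible≡χ∣Q : ∀ {a b} → ¬ p ∣ a → ¬ p ∣ b → ∑ (pred p) (λ c → χ (admissible? p a b c)) ≡ χ (p ∣? Q a b)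
  ∑-admissible≡χ∣Q {a} {b} p∤a p∤b with p ∣? Q a b
  ... | no p∤Q = ∑-zero (pred p) λ c _ _ → χ-no (admissible? p a b c)
                   λ (_ , p∣a+b+c , p∣e₂) → p∤Q (Equivalence.to (∣e₂⇔∣Q a b c p∣a+b+c) p∣e₂)
  ... | yes p∣Q = trans (∑-cong (pred p) λ c 1≤c c≤p-1 → χ-cong (admissible? p a b c) (c ≟ c₀) (mk⇔
                          (λ (_ , p∣a+b+c , _) → ∣+-unique p∣a+b+c (∣+neg (a + b)) (m≤pred[n]⇒suc[m]≤n c≤p-1) c₀<p)
                          (λ { refl → admissible-c₀ })))
                        (∑-indicator (pred p) c₀ 1≤c₀ (<⇒≤pred c₀<p))
    where
    c₀ = neg (a + b)
    c₀-residue = neg-residue (∣Q⇒∤a+b p∤a p∣Q)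
    1≤c₀ = proj₁ c₀-residue
    c₀<p = proj₂ c₀-residue
    admissible-c₀ : Admissible p a b c₀
    admissible-c₀ = ∤-* (∤-* p∤a p∤b) (∤-residue 1≤c₀ c₀<p) , ∣+neg (a + b) , Equivalence.from (∣e₂⇔∣Q a b c₀ (∣+neg (a + b))) p∣Q

  Q-cong : ∀ {a a′ b b′} → a ≈ a′ → b ≈ b′ → Q a b ≈ Q a′ b′
  Q-cong a≈ b≈ = +-cong (+-cong (*-cong a≈ a≈) (*-cong a≈ b≈)) (*-cong b≈ b≈)

  rootCount : ℕ → ℕ
  rootCount a = ∑ (pred p) (λ b → χ (p ∣? Q a b))

  ∑-scale : ∀ {a} → ¬ p ∣ a → ∀ f → ∑ (pred p) (λ b → f ((a * b) % p)) ≡ ∑ (pred p) f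
  ∑-scale {a} p∤a f with ∃-inverse p∤a
  ... | u , ua≈1 = ∑-permute (pred p) (record
    { σ-closed   = scale-closed p∤a
    ; σ⁻¹-closed = scale-closed p∤u
    ; inverseˡ   = λ b _ b≤p-1 → unscale {a} {u} ua≈1 b (m≤pred[n]⇒suc[m]≤n b≤p-1)
    ; inverseʳ   = λ b _ b≤p-1 → unscale {u} {a} au≈1 b (m≤pred[n]⇒suc[m]≤n b≤p-1)
    }) f
    where
    au≈1 : a * u ≈ 1
    au≈1 = ≈-trans (≈-reflexive (*-comm a u)) ua≈1
    p∤u : ¬ p ∣ u
    p∤u p∣u = p∤1 (∣-resp-≈ ua≈1 (∣m⇒∣m*n a p∣u))
    scale-closed : ∀ {c} → ¬ p ∣ c → ∀ b → 1 ≤ b → b ≤ pred p → 1 ≤ (c * b) % p × (c * b) % p ≤ pred p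
    scale-closed {c} p∤c b 1≤b b≤p-1 =
      ∤⇒1≤% (∤-* p∤c (∤-residue 1≤b (m≤pred[n]⇒suc[m]≤n b≤p-1))) , <⇒≤pred (m%n<n (c * b) p)
    unscale : ∀ {c d} → d * c ≈ 1 → ∀ b → b < p → (d * ((c * b) % p)) % p ≡ b
    unscale {c} {d} dc≈1 b b<p = ≈⇒≡ (begin
      (d * ((c * b) % p)) % p  ≈⟨ %-≈ _ ⟩
      d * ((c * b) % p)        ≈⟨ *-cong (≈-refl {d}) (%-≈ (c * b)) ⟩
      d * (c * b)              ≡⟨ *-assoc d c b ⟨
      d * c * b                ≈⟨ *-cong dc≈1 (≈-refl {b}) ⟩
      1 * b                    ≡⟨ *-identityˡ b ⟩
      b                        ∎) (m%n<n _ p) b<p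
      where open ≈-Reasoning

  rootCount-scale : ∀ {a} → ¬ p ∣ a → rootCount a ≡ rootCount 1
  rootCount-scale {a} p∤a = begin
    rootCount a                                          ≡⟨ ∑-scale p∤a (λ b → χ (p ∣? Q a b)) ⟨
    ∑ (pred p) (λ b → χ (p ∣? Q a ((a * b) % p)))        ≡⟨ ∑-cong (pred p) (λ b _ _ → χ-cong (p ∣? _) (p ∣? Q 1 b) (mk⇔
                                                              (Equivalence.to (∣*⇔∣ (∤-* p∤a p∤a)) ∘ ∣-resp-≈ (Q[a,ab%p]≈a²Q[1,b] b))
                                                              (∣-resp-≈ (≈-sym (Q[a,ab%p]≈a²Q[1,b] b)) ∘ ∣n⇒∣m*n (a * a)))) ⟩
    rootCount 1                                          ∎
    where
    open ≡-Reasoning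
    Q[a,ab%p]≈a²Q[1,b] : ∀ b → Q a ((a * b) % p) ≈ (a * a) * Q 1 b
    Q[a,ab%p]≈a²Q[1,b] b = ≈-trans (Q-cong (≈-refl {a}) (%-≈ (a * b))) (≈-reflexive (Q-scale a b))

  ∑³-admissible≡[p-1]*rootCount₁ : ∑³ p (λ a b c → χ (admissible? p a b c)) ≡ pred p * rootCount 1
  ∑³-admissible≡[p-1]*rootCount₁ = begin
    ∑³ p (λ a b c → χ (admissible? p a b c))
      ≡⟨ ∑³-dropLast p _ (λ b c → χ-no (admissible? p p b c) λ (p∤pbc , _) → p∤pbc (∣m⇒∣m*n c (∣m⇒∣m*n b ∣-refl)))
                         (λ a c → χ-no (admissible? p a p c) λ (p∤apc , _) → p∤apc (∣m⇒∣m*n c (n∣m*n a)))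
                         (λ a b → χ-no (admissible? p a b p) λ (p∤abp , _) → p∤abp (n∣m*n (a * b))) ⟩
    ∑³ (pred p) (λ a b c → χ (admissible? p a b c))
      ≡⟨ ∑-cong (pred p) (λ a 1≤a a≤p-1 → ∑-cong (pred p) λ b 1≤b b≤p-1 →
           ∑-admissible≡χ∣Q (∤-residue 1≤a (m≤pred[n]⇒suc[m]≤n a≤p-1)) (∤-residue 1≤b (m≤pred[n]⇒suc[m]≤n b≤p-1))) ⟩
    ∑ (pred p) rootCount
      ≡⟨ ∑-cong (pred p) (λ a 1≤a a≤p-1 → rootCount-scale (∤-residue 1≤a (m≤pred[n]⇒suc[m]≤n a≤p-1))) ⟩
    ∑ (pred p) (λ _ → rootCount 1)
      ≡⟨ ∑-const (pred p) (rootCount 1) ⟩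
    pred p * rootCount 1 ∎
    where open ≡-Reasoning

  ψ≡p^3k*[p-1]*rootCount₁ : ∀ k → ψ p (suc k) ≡ p ^ (3 * k) * (pred p * rootCount 1)
  ψ≡p^3k*[p-1]*rootCount₁ k = trans (ψ≡p^3k*∑³ k) (cong (p ^ (3 * k) *_) ∑³-admissible≡[p-1]*rootCount₁)

  Q-conjugate : ∀ {a b c} → p ∣ a + b + c → p ∣ Q a b → p ∣ Q a c
  Q-conjugate {a} {b} {c} p∣a+b+c p∣Q[a,b] =
    ∣m+n∣n⇒∣m (subst (p ∣_) (sym (Q-difference a b c)) (∣m∣n⇒∣m+n p∣Q[a,b] (∣n⇒∣m*n c p∣a+b+c)))
                    (∣n⇒∣m*n b p∣a+b+c)

  Q-roots-sum : ∀ {a b c} → p ∣ Q a b → p ∣ Q a c → b ≢ c → b < p → c < p → p ∣ a + b + c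
  Q-roots-sum {a} {b} {c} p∣Q[a,b] p∣Q[a,c] b≢c b<p c<p with p ∣? a + b + c
  ... | yes p∣a+b+c = p∣a+b+c
  ... | no  p∤a+b+c = contradiction (≈⇒≡ (*-cancelʳ-≈ p∤a+b+c b[a+b+c]≈c[a+b+c]) b<p c<p) b≢c
    where
    open ≈-Reasoning
    b[a+b+c]≈c[a+b+c] : b * (a + b + c) ≈ c * (a + b + c)
    b[a+b+c]≈c[a+b+c] = begin
      b * (a + b + c)             ≈⟨ ∣⇒+-≈ _ p∣Q[a,c] ⟨
      Q a c + b * (a + b + c)     ≡⟨ Q-difference a b c ⟩
      Q a b + c * (a + b + c)     ≈⟨ ∣⇒+-≈ _ p∣Q[a,b] ⟩
      c * (a + b + c)             ∎

  conjugate-distinct : ¬ p ∣ 3 → ∀ {a b} → ¬ p ∣ a → p ∣ Q a b → ¬ p ∣ a + b + b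
  conjugate-distinct p∤3 {a} {b} p∤a p∣Q[a,b] p∣a+b+b = ∤-* p∤3 (∤-* p∤a p∤a)
    (∣m+n∣m⇒∣n (subst (p ∣_) (4Q≡square+3a² a b) (∣n⇒∣m*n 4 p∣Q[a,b])) (∣m⇒∣m*n (a + b + b) p∣a+b+b))

  rootCount≡2 : ¬ p ∣ 3 → ∀ {a b} → ¬ p ∣ a → 1 ≤ b → b < p → p ∣ Q a b → rootCount a ≡ 2
  rootCount≡2 p∤3 {a} {b} p∤a 1≤b b<p p∣Q[a,b] = begin
    rootCount a
      ≡⟨ ∑-cong (pred p) (λ c _ c≤p-1 → χ-cong (p ∣? Q a c) (c ≟ b ⊎-dec c ≟ b′) (roots c (m≤pred[n]⇒suc[m]≤n c≤p-1))) ⟩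
    ∑ (pred p) (λ c → χ (c ≟ b ⊎-dec c ≟ b′))
      ≡⟨ ∑-cong (pred p) (λ c _ _ → χ-⊎ (c ≟ b) (c ≟ b′) (λ (c≡b , c≡b′) → b≢b′ (trans (sym c≡b) c≡b′))) ⟩
    ∑ (pred p) (λ c → χ (c ≟ b) + χ (c ≟ b′))
      ≡⟨ ∑-distrib-+ (pred p) _ _ ⟩
    ∑ (pred p) (λ c → χ (c ≟ b)) + ∑ (pred p) (λ c → χ (c ≟ b′))
      ≡⟨ cong₂ _+_ (∑-indicator (pred p) b 1≤b (<⇒≤pred b<p)) (∑-indicator (pred p) b′ 1≤b′ (<⇒≤pred b′<p)) ⟩
    2 ∎
    where
    open ≡-Reasoning
    b′ = neg (a + b)
    b′-residue = neg-residue (∣Q⇒∤a+b p∤a p∣Q[a,b])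
    1≤b′ = proj₁ b′-residue
    b′<p = proj₂ b′-residue
    b≢b′ : b ≢ b′
    b≢b′ b≡b′ = conjugate-distinct p∤3 p∤a p∣Q[a,b] (subst (λ x → p ∣ a + b + x) (sym b≡b′) (∣+neg (a + b)))
    roots : ∀ c → c < p → p ∣ Q a c ⇔ (c ≡ b ⊎ c ≡ b′)
    roots c c<p = mk⇔ to [ (λ { refl → p∣Q[a,b] }) , (λ { refl → Q-conjugate {a} {b} {b′} (∣+neg (a + b)) p∣Q[a,b] }) ]′
      where
      to : p ∣ Q a c → c ≡ b ⊎ c ≡ b′
      to p∣Q[a,c] with c ≟ b
      ... | yes c≡b = inj₁ c≡b
      ... | no  c≢b = inj₂ (∣+-unique (Q-roots-sum p∣Q[a,b] p∣Q[a,c] (c≢b ∘ sym) b<p c<p) (∣+neg (a + b)) c<p b′<p)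

  rootCount≡0⊎2 : ¬ p ∣ 3 → ∀ {a} → ¬ p ∣ a → rootCount a ≡ 0 ⊎ rootCount a ≡ 2
  rootCount≡0⊎2 p∤3 {a} p∤a with ∑-χ≡0⊎∃ (pred p) (λ b → p ∣? Q a b)
  ... | inj₁ none                    = inj₁ none
  ... | inj₂ (b , 1≤b , b≤p-1 , p∣Q) = inj₂ (rootCount≡2 p∤3 p∤a 1≤b (m≤pred[n]⇒suc[m]≤n b≤p-1) p∣Q)

  ≤p-2⇒1+b<p : ∀ {b} → b ≤ pred (pred p) → suc b < p
  ≤p-2⇒1+b<p = go 1<p
    where
    go : ∀ {m n} → 1 < n → m ≤ pred (pred n) → suc m < n
    go {n = suc zero}    (s≤s ()) _
    go {n = suc (suc _)} _        m≤n-2 = s≤s (s≤s m≤n-2)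

  ∤1+b : ∀ {b} → b ≤ pred (pred p) → ¬ p ∣ suc b
  ∤1+b b≤p-2 = ∤-residue (s≤s z≤n) (≤p-2⇒1+b<p b≤p-2)

  -- On 1 ≤ b ≤ p − 2 this is b ↦ −1/(b + 1) mod p (the junk value 0 is never reached there).
  τ : ℕ → ℕ
  τ b with anyUpTo? (λ y → p ∣? y * suc b + 1) p
  ... | yes (y , _) = y
  ... | no _        = 0

  τ-spec : ∀ {b} → ¬ p ∣ suc b → τ b < p × p ∣ τ b * suc b + 1
  τ-spec {b} p∤1+b with anyUpTo? (λ y → p ∣? y * suc b + 1) p
  ... | yes (_ , y<p , p∣y[b+1]+1) = y<p , p∣y[b+1]+1
  ... | no ∄y                      = contradiction (∃-negInverse p∤1+b) ∄y

  τ-closed : ∀ b → 1 ≤ b → b ≤ pred (pred p) → 1 ≤ τ b × τ b ≤ pred (pred p)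
  τ-closed b 1≤b b≤p-2 =
    n≢0⇒n>0 (λ τb≡0 → p∤1 (subst (λ y → p ∣ y * suc b + 1) τb≡0 p∣τb[b+1]+1)) ,
    <⇒≤pred (≤∧≢⇒< (<⇒≤pred τb<p) τb≢p-1)
    where
    τb<p = proj₁ (τ-spec (∤1+b b≤p-2))
    p∣τb[b+1]+1 = proj₂ (τ-spec (∤1+b b≤p-2))
    [p-1][b+1]+1+b≡p[b+1] : pred p * suc b + 1 + b ≡ p * suc b
    [p-1][b+1]+1+b≡p[b+1] = trans (identity (pred p) b) (cong (_* suc b) (suc-pred p))
      where
      identity : ∀ n b → n * suc b + 1 + b ≡ suc n * suc b
      identity = solve-∀
    τb≢p-1 : τ b ≢ pred p
    τb≢p-1 τb≡p-1 = ∤-residue 1≤b (<-trans (n<1+n b) (≤p-2⇒1+b<p b≤p-2))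
      (∣m+n∣m⇒∣n (subst (p ∣_) (sym [p-1][b+1]+1+b≡p[b+1]) (m∣m*n (suc b)))
                 (subst (λ y → p ∣ y * suc b + 1) τb≡p-1 p∣τb[b+1]+1))

  τ-step : ∀ {b y z} → p ∣ y * suc b + 1 → p ∣ z * suc y + 1 → p ∣ b * suc z + 1
  τ-step {b} {y} {z} p∣y[b+1]+1 p∣z[y+1]+1 =
    ∣m+n∣n⇒∣m (subst (p ∣_) (identity b y z) (∣n⇒∣m*n (suc b) p∣z[y+1]+1)) (∣n⇒∣m*n z p∣y[b+1]+1)
    where
    identity : ∀ b y z → suc b * (z * suc y + 1) ≡ (b * suc z + 1) + z * (y * suc b + 1)
    identity = solve-∀

  τ³≡id : ∀ b → 1 ≤ b → b ≤ pred (pred p) → τ (τ (τ b)) ≡ b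
  τ³≡id b 1≤b b≤p-2 =
    negInverse-unique (∤1+b z≤p-2) (proj₂ (τ-spec (∤1+b z≤p-2)))
      (τ-step {b} {τ b} {τ (τ b)} (proj₂ (τ-spec (∤1+b b≤p-2))) (proj₂ (τ-spec (∤1+b y≤p-2))))
      (proj₁ (τ-spec (∤1+b z≤p-2))) (<-trans (n<1+n b) (≤p-2⇒1+b<p b≤p-2))
    where
    y≤p-2 = proj₂ (τ-closed b 1≤b b≤p-2)
    z≤p-2 = proj₂ (uncurry (τ-closed (τ b)) (τ-closed b 1≤b b≤p-2))

  τ-fixed⇔ : ∀ b → 1 ≤ b → b ≤ pred (pred p) → τ b ≡ b ⇔ p ∣ Q 1 b
  τ-fixed⇔ b 1≤b b≤p-2 = mk⇔
    (λ τb≡b → subst (p ∣_) (sym (Q[1,b]≡b[b+1]+1 b)) (subst (λ y → p ∣ y * suc b + 1) τb≡b p∣τb[b+1]+1))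
    (λ p∣Q → negInverse-unique (∤1+b b≤p-2) p∣τb[b+1]+1 (subst (p ∣_) (Q[1,b]≡b[b+1]+1 b) p∣Q)
                               (proj₁ (τ-spec (∤1+b b≤p-2))) (<-trans (n<1+n b) (≤p-2⇒1+b<p b≤p-2)))
    where
    p∣τb[b+1]+1 = proj₂ (τ-spec (∤1+b b≤p-2))
    Q[1,b]≡b[b+1]+1 : ∀ b → 1 * 1 + 1 * b + b * b ≡ b * suc b + 1
    Q[1,b]≡b[b+1]+1 = solve-∀

  #fixed[τ]≡rootCount₁ : ∑ (pred (pred p)) (λ b → χ (τ b ≟ b)) ≡ rootCount 1
  #fixed[τ]≡rootCount₁ = begin
    ∑ (pred (pred p)) (λ b → χ (τ b ≟ b))
      ≡⟨ ∑-cong (pred (pred p)) (λ b 1≤b b≤p-2 → χ-cong (τ b ≟ b) (p ∣? Q 1 b) (τ-fixed⇔ b 1≤b b≤p-2)) ⟩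
    ∑ (pred (pred p)) (λ b → χ (p ∣? Q 1 b))
      ≡⟨ ∑-dropLast (pred p) (λ b → χ (p ∣? Q 1 b)) (χ-no (p ∣? Q 1 (pred p)) p∤Q[1,p-1]) ⟨
    rootCount 1 ∎
    where
    open ≡-Reasoning
    p∤Q[1,p-1] : ¬ p ∣ Q 1 (pred p)
    p∤Q[1,p-1] p∣Q = p∤1 (∣m+n∣n⇒∣m
      (subst (p ∣_) (trans (Q[1,n]≡1+[n+1]n (pred p)) (cong (λ n → 1 + n * pred p) (suc-pred p))) p∣Q)
      (m∣m*n (pred p)))
      where
      Q[1,n]≡1+[n+1]n : ∀ n → 1 * 1 + 1 * n + n * n ≡ 1 + suc n * n
      Q[1,n]≡1+[n+1]n = solve-∀

  p-2≡3q+rootCount₁ : ∃[ q ] pred (pred p) ≡ 3 * q + rootCount 1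
  p-2≡3q+rootCount₁ =
    let q , p-2≡3q+#fixed = fixedPoints≡[mod3] (pred (pred p)) τ τ-closed τ³≡id
    in  q , trans p-2≡3q+#fixed (cong (3 * q +_) #fixed[τ]≡rootCount₁)

  p%3≡[r+2]%3 : ∀ {r} → rootCount 1 ≡ r → p % 3 ≡ (r + 2) % 3
  p%3≡[r+2]%3 {r} refl = begin
    p % 3                   ≡⟨ cong (_% 3) (trans (sym (pred²+2 1<p)) (cong (_+ 2) p-2≡3q+r)) ⟩
    (3 * q + r + 2) % 3     ≡⟨ cong (_% 3) (rearrange q r) ⟩
    (r + 2 + q * 3) % 3     ≡⟨ [m+kn]%n≡m%n (r + 2) q 3 ⟩
    (r + 2) % 3             ∎
    where
    open ≡-Reasoning
    q = proj₁ p-2≡3q+rootCount₁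
    p-2≡3q+r = proj₂ p-2≡3q+rootCount₁
    pred²+2 : ∀ {n} → 1 < n → pred (pred n) + 2 ≡ n
    pred²+2 {suc zero}    (s≤s ())
    pred²+2 {suc (suc n)} _        = +-comm n 2
    rearrange : ∀ q r → 3 * q + r + 2 ≡ r + 2 + q * 3
    rearrange = solve-∀

  rootCount₁-mod3 : ¬ p ∣ 3 → (p % 3 ≡ 1 → rootCount 1 ≡ 2) × (p % 3 ≡ 2 → rootCount 1 ≡ 0)
  rootCount₁-mod3 p∤3 with rootCount≡0⊎2 p∤3 p∤1
  ... | inj₁ r≡0 = (λ p%3≡1 → contradiction (trans (sym p%3≡1) (p%3≡[r+2]%3 r≡0)) λ ()) , (λ _ → r≡0)
  ... | inj₂ r≡2 = (λ _ → r≡2) , (λ p%3≡2 → contradiction (trans (sym p%3≡2) (p%3≡[r+2]%3 r≡2)) λ ())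

∣3⇒≡3 : ∀ {p} → Prime p → p ∣ 3 → p ≡ 3
∣3⇒≡3 {0}                       p-prime _   = contradiction p-prime ¬prime[0]
∣3⇒≡3 {1}                       p-prime _   = contradiction p-prime ¬prime[1]
∣3⇒≡3 {2}                       _       2∣3 = contradiction (n∣m⇒m%n≡0 3 2 2∣3) λ ()
∣3⇒≡3 {3}                       _       _   = refl
∣3⇒≡3 {suc (suc (suc (suc _)))} _       p∣3 = contradiction (∣⇒≤ p∣3) λ { (s≤s (s≤s (s≤s ()))) }

mainTheorem14 : (p k : ℕ) .{{_ : NonZero p}} → Prime p → k ≥ 1 →
    ((p ≡ 3 → ψ p k ≡ p ^ (3 * (k ∸ 1)) * (p ∸ 1)) ×
     (p % 3 ≡ 1 → ψ p k ≡ 2 * p ^ (3 * (k ∸ 1)) * (p ∸ 1)) ×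
     (p % 3 ≡ 2 → ψ p k ≡ 0))
mainTheorem14 p (suc k) p-prime _ =
    -- for p = 3, rootCount 1 evaluates to 1
    (λ { refl → ψ≡p^3k*[p-1]*rootCount₁ k })
  , (λ p%3≡1 → begin
      ψ p (suc k)                            ≡⟨ ψ≡p^3k*[p-1]*rootCount₁ k ⟩
      p ^ (3 * k) * (pred p * rootCount 1)   ≡⟨ cong (λ r → p ^ (3 * k) * (pred p * r)) (proj₁ (rootCount₁-mod3 (p∤3 1+n≢0 p%3≡1)) p%3≡1) ⟩
      p ^ (3 * k) * (pred p * 2)             ≡⟨ reorder (p ^ (3 * k)) (pred p) ⟩
      2 * p ^ (3 * k) * (p ∸ 1)              ∎)
  , (λ p%3≡2 → begin
      ψ p (suc k)                            ≡⟨ ψ≡p^3k*[p-1]*rootCount₁ k ⟩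
      p ^ (3 * k) * (pred p * rootCount 1)   ≡⟨ cong (λ r → p ^ (3 * k) * (pred p * r)) (proj₂ (rootCount₁-mod3 (p∤3 1+n≢0 p%3≡2)) p%3≡2) ⟩
      p ^ (3 * k) * (pred p * 0)             ≡⟨ cong (p ^ (3 * k) *_) (*-zeroʳ (pred p)) ⟩
      p ^ (3 * k) * 0                        ≡⟨ *-zeroʳ (p ^ (3 * k)) ⟩
      0                                      ∎)
  where
  open ≡-Reasoning
  open Counting p-prime using (ψ≡p^3k*[p-1]*rootCount₁; rootCount; rootCount₁-mod3)
  p∤3 : ∀ {r} → r ≢ 0 → p % 3 ≡ r → ¬ p ∣ 3
  p∤3 r≢0 p%3≡r p∣3 = r≢0 (trans (sym p%3≡r) (cong (_% 3) (∣3⇒≡3 p-prime p∣3)))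
  reorder : ∀ x y → x * (y * 2) ≡ 2 * x * y
  reorder = solve-∀
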